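{- Let $\ell,\ell_{out}$ be positive integers with $\ell\ge\ell_{out}$, let $m=2^{\ell_{out}}$ and let $n<m$. For an $\ell$-bit multiplier $a$ let $h_a(x)=\lfloor (ax\bmod 2^\ell)/2^{\ell-\ell_{out}}\rfloor$ and $h^0_a(x) = (ax\bmod 2^\ell)/2^\ell\in[0,1)$. Suppose that for some $x\in\{1,\dots,n-1\}$ we have $\|h^0_a(x)\|\le 1/(2m)$. Then, when $h_a$ is used to insert the keys $[n]=\{0,\dots,n-1\}$ into a linear probing table of size $m$, the average insertion cost per key is $\Omega(n/x)$.
   Context: For real $y$, $\|y\|=\min\{y\bmod 1, -y\bmod 1\}$, the distance from $0$ in the circular unit interval. Linear probing: the table is an array of $m$ cells indexed cyclically; to insert $x$, the cells $h(x),h(x)+1,\dots$ (mod $m$) are scanned and $x$ is placed in the first empty cell; the insertion cost is the number of cells scanned, and the average cost is the total divided by $n$. -}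

module Defs where

open import Data.Nat using (ℕ; zero; suc; _+_; _*_; _∸_; _^_; _≤_; _<_; _≡ᵇ_; NonZero)
open import Data.Nat.Properties using (m^n≢0)
open import Data.Nat.DivMod using (_%_; _/_)
open import Data.Bool using (Bool; true; false; if_then_else_)
open import Data.List using (List; []; _∷_; upTo)
open import Data.Bool.ListAction using (any)
open import Data.Product using (_×_; _,_; proj₁; proj₂)


prodMod : (ℓ a x : ℕ) → ℕ
prodMod ℓ a x = _%_ (a * x) (2 ^ ℓ) {{m^n≢0 2 ℓ}}

hashA : (ℓ ℓout a x : ℕ) → ℕ
hashA ℓ ℓout a x = _/_ (prodMod ℓ a x) (2 ^ (ℓ ∸ ℓout)) {{m^n≢0 2 (ℓ ∸ ℓout)}}

-- ‖h⁰_a(x)‖ ≤ 1/(2m) where h⁰_a(x) = r / 2^ℓ, r = a x mod 2^ℓ ∈ [0, 2^ℓ).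
-- ‖r/2^ℓ‖ = min(r, 2^ℓ - r)/2^ℓ, so the condition is  2m · min(r, 2^ℓ - r) ≤ 2^ℓ,
-- written as a disjunction to avoid min.
data NearZero (ℓ m a x : ℕ) : Set where
  low  : 2 * m * prodMod ℓ a x ≤ 2 ^ ℓ → NearZero ℓ m a x
  high : 2 * m * (2 ^ ℓ ∸ prodMod ℓ a x) ≤ 2 ^ ℓ → NearZero ℓ m a x

occupied : List ℕ → ℕ → Bool
occupied occ p = any (λ q → q ≡ᵇ p) occ

-- The fuel bounds the scan; with fuel m and fewer than m occupied cells
-- an empty cell is always found before the fuel is exhausted.
probe : (m : ℕ) .{{_ : NonZero m}} → List ℕ → (fuel p : ℕ) → ℕ × ℕ
probe m occ zero p = p , 0
probe m occ (suc f) p with occupied occ p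
... | false = p , 1
... | true  = let r = probe m occ f ((suc p) % m) in proj₁ r , suc (proj₂ r)

insertAll : (m : ℕ) .{{_ : NonZero m}} → (ℕ → ℕ) → List ℕ → List ℕ → List ℕ × ℕ
insertAll m h occ [] = occ , 0
insertAll m h occ (k ∷ ks) =
  let r = probe m occ m (h k % m)
      s = insertAll m h (proj₁ r ∷ occ) ks
  in proj₁ s , proj₂ r + proj₂ s

totalCost : (ℓ ℓout a n : ℕ) → ℕ
totalCost ℓ ℓout a n =
  proj₂ (insertAll (2 ^ ℓout) {{m^n≢0 2 ℓout}} (hashA ℓ ℓout a) [] (upTo n))

-- Let r = a x mod 2^ℓ. The hypothesis says that r or 2^ℓ − r is at most 2^ℓ/(2m), half the width
-- 2^(ℓ−ℓout) of the range of products hashed to one cell. Take K = ⌊n/x⌋ and a residue y < x. Then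
-- the home cell of key i x + y lies at most (i+1)/2 cells past the home of key y, or, when 2^ℓ − r
-- is the small one, at most (K−i)/2 cells past the home of the last key (K−1) x + y. These K keys
-- occupy K distinct cells, whose offsets from that anchor sum to at least 0 + 1 + ⋯ + (K−1), while
-- the offsets of their homes sum to at most K(K+1)/4; as each key is placed cost − 1 cells past its
-- home, the class costs at least K(K+1)/4. Summing over the x classes, the total cost is at least
-- x K(K+1)/4 ≥ n²/(8x).

module Submission where

open import Data.Bool using (true; false)
open import Data.Bool.Properties using (∨-zeroʳ)
open import Data.Empty using (⊥-elim)
open import Data.Fin using (Fin; toℕ; fromℕ<)
open import Data.Fin.Properties using (pigeonhole; toℕ<n; toℕ-fromℕ<)
open import Data.List using (List; []; _∷_; length; applyUpTo; upTo)
open import Data.List.Properties using (length-applyUpTo)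
open import Data.List.Relation.Binary.Permutation.Propositional using (↭⇒↭ₛ; ↭-sym)
open import Data.List.Relation.Binary.Permutation.Propositional.Properties using (↭-length)
import Data.List.Relation.Binary.Permutation.Setoid.Properties as SetoidPermProps
open import Data.List.Relation.Unary.All using (_∷_)
open import Data.List.Relation.Unary.AllPairs using (_∷_)
open import Data.List.Relation.Unary.Linked using (Linked; _∷_)
open import Data.List.Relation.Unary.Unique.Propositional using (Unique)
open import Data.List.Relation.Unary.Unique.Propositional.Properties using (applyUpTo⁺₁)
import Data.List.Sort as Sort
open import Data.Nat
open import Data.Nat.DivMod
open import Data.Nat.ListAction using (sum)
open import Data.Nat.ListAction.Properties using (sum-↭)
open import Data.Nat.Properties
open import Data.Nat.Solver using (module +-*-Solver)
open import Data.Product using (Σ; _×_; _,_; proj₁; proj₂; ∃-syntax)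
open import Data.Sum using (_⊎_; inj₁; inj₂)
open import Function using (id; case_of_)
open import Relation.Binary.Definitions using (tri<; tri≈; tri>)
open import Relation.Binary.PropositionalEquality
open import Relation.Nullary using (¬_)

open import Defs

open import Algebra.Properties.CommutativeSemigroup +-commutativeSemigroup using (interchange; xy∙z≈xz∙y; x∙yz≈y∙xz)
open +-*-Solver

∑ : ℕ → (ℕ → ℕ) → ℕ
∑ zero    f = 0
∑ (suc n) f = ∑ n f + f n

syntax ∑ n (λ i → e) = ∑[ i < n ] e

∑-cong : ∀ n {f g} → (∀ i → i < n → f i ≡ g i) → ∑ n f ≡ ∑ n g
∑-cong zero    eq = refl
∑-cong (suc n) eq = cong₂ _+_ (∑-cong n (λ i i<n → eq i (m<n⇒m<1+n i<n))) (eq n ≤-refl)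

∑-mono-≤ : ∀ n {f g} → (∀ i → i < n → f i ≤ g i) → ∑ n f ≤ ∑ n g
∑-mono-≤ zero    le = z≤n
∑-mono-≤ (suc n) le = +-mono-≤ (∑-mono-≤ n (λ i i<n → le i (m<n⇒m<1+n i<n))) (le n ≤-refl)

∑-const : ∀ n c → ∑[ i < n ] c ≡ n * c
∑-const zero    c = refl
∑-const (suc n) c = trans (cong (_+ c) (∑-const n c)) (+-comm (n * c) c)

∑-distrib-+ : ∀ n f g → ∑[ i < n ] (f i + g i) ≡ ∑ n f + ∑ n g
∑-distrib-+ zero    f g = refl
∑-distrib-+ (suc n) f g = begin
  ∑[ i < n ] (f i + g i) + (f n + g n) ≡⟨ cong (_+ (f n + g n)) (∑-distrib-+ n f g) ⟩
  ∑ n f + ∑ n g + (f n + g n)         ≡⟨ interchange (∑ n f) (∑ n g) (f n) (g n) ⟩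
  ∑ n f + f n + (∑ n g + g n)         ∎
  where open ≡-Reasoning

∑-distribˡ-* : ∀ n c f → ∑[ i < n ] (c * f i) ≡ c * ∑ n f
∑-distribˡ-* zero    c f = sym (*-zeroʳ c)
∑-distribˡ-* (suc n) c f =
  trans (cong (_+ c * f n) (∑-distribˡ-* n c f)) (sym (*-distribˡ-+ c (∑ n f) (f n)))

*-∑-mono-≤ : ∀ n c {f g} → (∀ i → i < n → c * f i ≤ g i) → c * ∑ n f ≤ ∑ n g
*-∑-mono-≤ n c {f} {g} le = subst (_≤ ∑ n g) (∑-distribˡ-* n c f) (∑-mono-≤ n le)

∑-suc : ∀ n f → ∑[ i < n ] suc (f i) ≡ ∑ n f + n
∑-suc zero    f = refl
∑-suc (suc n) f = begin
  ∑[ i < n ] suc (f i) + suc (f n) ≡⟨ cong (_+ suc (f n)) (∑-suc n f) ⟩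
  ∑ n f + n + suc (f n)            ≡⟨ solve 3 (λ s n x → s :+ n :+ (con 1 :+ x) := s :+ x :+ (con 1 :+ n)) refl (∑ n f) n (f n) ⟩
  ∑ n f + f n + suc n              ∎
  where open ≡-Reasoning

∑-unfoldˡ : ∀ n f → ∑ (suc n) f ≡ f 0 + ∑[ i < n ] f (suc i)
∑-unfoldˡ zero    f = +-comm 0 (f 0)
∑-unfoldˡ (suc n) f =
  trans (cong (_+ f (suc n)) (∑-unfoldˡ n f)) (+-assoc (f 0) (∑[ i < n ] f (suc i)) (f (suc n)))

∑-reverse : ∀ n f → ∑[ i < n ] f (n ∸ suc i) ≡ ∑ n f
∑-reverse zero    f = refl
∑-reverse (suc n) f = begin
  ∑[ i < suc n ] f (suc n ∸ suc i)        ≡⟨ ∑-unfoldˡ n (λ i → f (suc n ∸ suc i)) ⟩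
  f n + ∑[ i < n ] f (n ∸ suc i)          ≡⟨ cong (f n +_) (∑-reverse n f) ⟩
  f n + ∑ n f                             ≡⟨ +-comm (f n) (∑ n f) ⟩
  ∑ n f + f n                             ∎
  where open ≡-Reasoning

∑-split : ∀ a b f → ∑ (a + b) f ≡ ∑ a f + ∑[ i < b ] f (a + i)
∑-split a zero    f = trans (cong (λ n → ∑ n f) (+-identityʳ a)) (sym (+-identityʳ (∑ a f)))
∑-split a (suc b) f = begin
  ∑ (a + suc b) f                              ≡⟨ cong (λ n → ∑ n f) (+-suc a b) ⟩
  ∑ (a + b) f + f (a + b)                      ≡⟨ cong (_+ f (a + b)) (∑-split a b f) ⟩
  ∑ a f + ∑[ i < b ] f (a + i) + f (a + b)     ≡⟨ +-assoc (∑ a f) _ _ ⟩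
  ∑ a f + ∑[ i < suc b ] f (a + i)             ∎
  where open ≡-Reasoning

∑-monoˡ-≤ : ∀ f {n n′} → n ≤ n′ → ∑ n f ≤ ∑ n′ f
∑-monoˡ-≤ f {n} n≤n′ with o , refl ← m≤n⇒∃[o]m+o≡n n≤n′ =
  subst (∑ n f ≤_) (sym (∑-split n o f)) (m≤m+n (∑ n f) _)

∑-blocks : ∀ K x f → ∑ (K * x) f ≡ ∑[ y < x ] ∑[ i < K ] f (i * x + y)
∑-blocks zero    x f = sym (trans (∑-const x 0) (*-zeroʳ x))
∑-blocks (suc K) x f = begin
  ∑ (x + K * x) f                                                  ≡⟨ cong (λ n → ∑ n f) (+-comm x (K * x)) ⟩
  ∑ (K * x + x) f                                                  ≡⟨ ∑-split (K * x) x f ⟩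
  ∑ (K * x) f + ∑[ y < x ] f (K * x + y)                           ≡⟨ cong (_+ ∑[ y < x ] f (K * x + y)) (∑-blocks K x f) ⟩
  ∑[ y < x ] ∑[ i < K ] f (i * x + y) + ∑[ y < x ] f (K * x + y)   ≡⟨ sym (∑-distrib-+ x _ _) ⟩
  ∑[ y < x ] ∑[ i < suc K ] f (i * x + y)                          ∎
  where open ≡-Reasoning

2*∑-suc≡n*[1+n] : ∀ n → 2 * ∑[ i < n ] suc i ≡ n * suc n
2*∑-suc≡n*[1+n] zero    = refl
2*∑-suc≡n*[1+n] (suc n) = begin
  2 * (∑[ i < n ] suc i + suc n)     ≡⟨ *-distribˡ-+ 2 (∑[ i < n ] suc i) (suc n) ⟩
  2 * ∑[ i < n ] suc i + 2 * suc n   ≡⟨ cong (_+ 2 * suc n) (2*∑-suc≡n*[1+n] n) ⟩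
  n * suc n + 2 * suc n              ≡⟨ solve 1 (λ n → n :* (con 1 :+ n) :+ con 2 :* (con 1 :+ n) := (con 1 :+ n) :* (con 2 :+ n)) refl n ⟩
  suc n * suc (suc n)                ∎
  where open ≡-Reasoning

sum-applyUpTo : ∀ n f → sum (applyUpTo f n) ≡ ∑ n f
sum-applyUpTo zero    f = refl
sum-applyUpTo (suc n) f = trans (cong (f 0 +_) (sum-applyUpTo n (λ i → f (suc i)))) (sym (∑-unfoldˡ n f))

∑-shift≤sum-increasing : ∀ {b} x xs → b ≤ x → Linked _≤_ (x ∷ xs) → Unique (x ∷ xs) →
                         ∑[ i < suc (length xs) ] (b + i) ≤ x + sum xs
∑-shift≤sum-increasing {b} x []       b≤x _ _ = +-monoˡ-≤ 0 b≤x
∑-shift≤sum-increasing {b} x (y ∷ xs) b≤x (x≤y ∷ sorted) ((x≢y ∷ _) ∷ unique) = begin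
  ∑[ i < suc (suc (length xs)) ] (b + i)         ≡⟨ ∑-unfoldˡ (suc (length xs)) (b +_) ⟩
  b + 0 + ∑[ i < suc (length xs) ] (b + suc i)   ≡⟨ cong₂ _+_ (+-identityʳ b) (∑-cong (suc (length xs)) (λ i _ → +-suc b i)) ⟩
  b + ∑[ i < suc (length xs) ] (suc b + i)       ≤⟨ +-mono-≤ b≤x (∑-shift≤sum-increasing y xs (≤-trans (s≤s b≤x) (≤∧≢⇒< x≤y x≢y)) sorted unique) ⟩
  x + (y + sum xs)                               ∎
  where open ≤-Reasoning

∑-index≤∑-distinct : ∀ n (v : ℕ → ℕ) → (∀ {i j} → i < j → j < n → v i ≢ v j) → ∑[ i < n ] i ≤ ∑ n v
∑-index≤∑-distinct n v distinct = subst₂ _≤_ ∑-index-sorted sum-sorted (bound sorted (NatSort.sort-↗ values) unique-sorted)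
  where
  module NatSort = Sort ≤-decTotalOrder
  values = applyUpTo v n
  sorted = NatSort.sort values
  unique-sorted : Unique sorted
  unique-sorted = SetoidPermProps.Unique-resp-↭ (setoid ℕ) (↭⇒↭ₛ (↭-sym (NatSort.sort-↭ values))) (applyUpTo⁺₁ v n distinct)
  bound : ∀ xs → Linked _≤_ xs → Unique xs → ∑[ i < length xs ] i ≤ sum xs
  bound []       _      _      = z≤n
  bound (x ∷ xs) sorted unique = ∑-shift≤sum-increasing x xs z≤n sorted unique
  ∑-index-sorted : ∑[ i < length sorted ] i ≡ ∑[ i < n ] i
  ∑-index-sorted = cong (λ k → ∑[ i < k ] i) (trans (↭-length (NatSort.sort-↭ values)) (length-applyUpTo v n))
  sum-sorted : sum sorted ≡ ∑ n v
  sum-sorted = trans (sum-↭ (NatSort.sort-↭ values)) (sum-applyUpTo n v)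

[1+n]*[1+n]≤4*∑-suc : ∀ {n} → 1 ≤ n → suc n * suc n ≤ 4 * ∑[ i < n ] suc i
[1+n]*[1+n]≤4*∑-suc {n} 1≤n = begin
  suc n * suc n                ≤⟨ *-monoˡ-≤ (suc n) (+-monoˡ-≤ n 1≤n) ⟩
  (n + n) * suc n              ≡⟨ cong (_* suc n) (cong (n +_) (sym (+-identityʳ n))) ⟩
  2 * n * suc n                ≡⟨ *-assoc 2 n (suc n) ⟩
  2 * (n * suc n)              ≡⟨ cong (2 *_) (sym (2*∑-suc≡n*[1+n] n)) ⟩
  2 * (2 * ∑[ i < n ] suc i)   ≡⟨ sym (*-assoc 2 2 (∑[ i < n ] suc i)) ⟩
  4 * ∑[ i < n ] suc i         ∎
  where open ≤-Reasoning

[m%n+o]%n≡[m+o]%n : ∀ a b n .{{_ : NonZero n}} → (a % n + b) % n ≡ (a + b) % n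
[m%n+o]%n≡[m+o]%n a b n = begin
  (a % n + b) % n           ≡⟨ %-distribˡ-+ (a % n) b n ⟩
  (a % n % n + b % n) % n   ≡⟨ cong (λ r → (r + b % n) % n) (m%n%n≡m%n a n) ⟩
  (a % n + b % n) % n       ≡⟨ sym (%-distribˡ-+ a b n) ⟩
  (a + b) % n               ∎
  where open ≡-Reasoning

[m+n%o]%o≡[m+n]%o : ∀ a b n .{{_ : NonZero n}} → (a + b % n) % n ≡ (a + b) % n
[m+n%o]%o≡[m+n]%o a b n = begin
  (a + b % n) % n   ≡⟨ cong (_% n) (+-comm a (b % n)) ⟩
  (b % n + a) % n   ≡⟨ [m%n+o]%n≡[m+o]%n b a n ⟩
  (b + a) % n       ≡⟨ cong (_% n) (+-comm b a) ⟩
  (a + b) % n       ∎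
  where open ≡-Reasoning

2*[[u+t]/s∸u/s]≤1+j : ∀ u t j s .{{_ : NonZero s}} → 2 * t ≤ j * s → 2 * ((u + t) / s ∸ u / s) ≤ suc j
2*[[u+t]/s∸u/s]≤1+j u t j s 2t≤js = m<1+n⇒m≤n (*-cancelʳ-< s (2 * d) (2 + j) (begin-strict
    2 * d * s                  ≡⟨ *-assoc 2 d s ⟩
    2 * (d * s)                <⟨ *-monoʳ-< 2 d*s<s+t ⟩
    2 * (s + t)                ≡⟨ *-distribˡ-+ 2 s t ⟩
    2 * s + 2 * t              ≤⟨ +-monoʳ-≤ (2 * s) 2t≤js ⟩
    2 * s + j * s              ≡⟨ sym (*-distribʳ-+ s 2 j) ⟩
    (2 + j) * s                ∎))
  where
  open ≤-Reasoning
  A = u / s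
  w = (u + t) / s
  d = w ∸ A
  d*s<s+t : d * s < s + t
  d*s<s+t = +-cancelʳ-< (A * s) (d * s) (s + t) (begin-strict
    d * s + A * s              ≡⟨ sym (*-distribʳ-+ s d A) ⟩
    (d + A) * s                ≡⟨ cong (_* s) (m∸n+n≡m (/-monoˡ-≤ s (m≤m+n u t))) ⟩
    w * s                      ≤⟨ m/n*n≤m (u + t) s ⟩
    u + t                      ≡⟨ cong (_+ t) (m≡m%n+[m/n]*n u s) ⟩
    u % s + A * s + t          <⟨ +-monoˡ-< t (+-monoˡ-< (A * s) (m%n<n u s)) ⟩
    s + A * s + t              ≡⟨ xy∙z≈xz∙y s (A * s) t ⟩
    s + t + A * s              ∎)

a[ix+y]%L : ∀ a x y i L .{{_ : NonZero L}} → a * (i * x + y) % L ≡ (a * y % L + i * (a * x % L)) % L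
a[ix+y]%L a x y i L = begin
  a * (i * x + y) % L                  ≡⟨ cong (_% L) expand ⟩
  (a * y + i * r + i * q * L) % L      ≡⟨ [m+kn]%n≡m%n (a * y + i * r) (i * q) L ⟩
  (a * y + i * r) % L                  ≡⟨ sym ([m%n+o]%n≡[m+o]%n (a * y) (i * r) L) ⟩
  (a * y % L + i * r) % L              ∎
  where
  open ≡-Reasoning
  r = a * x % L
  q = a * x / L
  expand : a * (i * x + y) ≡ a * y + i * r + i * q * L
  expand = begin
    a * (i * x + y)            ≡⟨ solve 4 (λ a x y i → a :* (i :* x :+ y) := a :* y :+ i :* (a :* x)) refl a x y i ⟩
    a * y + i * (a * x)        ≡⟨ cong (λ z → a * y + i * z) (m≡m%n+[m/n]*n (a * x) L) ⟩
    a * y + i * (r + q * L)    ≡⟨ solve 5 (λ ay i r q L → ay :+ i :* (r :+ q :* L) := ay :+ i :* r :+ i :* q :* L) refl (a * y) i r q L ⟩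
    a * y + i * r + i * q * L  ∎

a[c+jx]%L : ∀ a x c j L .{{_ : NonZero L}} → a * c % L ≡ (a * (c + j * x) % L + j * (L ∸ a * x % L)) % L
a[c+jx]%L a x c j L = sym (begin
  (a * (c + j * x) % L + j * (L ∸ r)) % L   ≡⟨ [m%n+o]%n≡[m+o]%n (a * (c + j * x)) (j * (L ∸ r)) L ⟩
  (a * (c + j * x) + j * (L ∸ r)) % L       ≡⟨ cong (_% L) expand ⟩
  (a * c + j * suc q * L) % L               ≡⟨ [m+kn]%n≡m%n (a * c) (j * suc q) L ⟩
  a * c % L                                 ∎)
  where
  open ≡-Reasoning
  r = a * x % L
  q = a * x / L
  ax+[L∸r]≡[1+q]*L : a * x + (L ∸ r) ≡ suc q * L
  ax+[L∸r]≡[1+q]*L = begin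
    a * x + (L ∸ r)            ≡⟨ cong (_+ (L ∸ r)) (m≡m%n+[m/n]*n (a * x) L) ⟩
    r + q * L + (L ∸ r)        ≡⟨ xy∙z≈xz∙y r (q * L) (L ∸ r) ⟩
    r + (L ∸ r) + q * L        ≡⟨ cong (_+ q * L) (m+[n∸m]≡n (m%n≤n (a * x) L)) ⟩
    L + q * L                  ∎
  expand : a * (c + j * x) + j * (L ∸ r) ≡ a * c + j * suc q * L
  expand = begin
    a * (c + j * x) + j * (L ∸ r)        ≡⟨ solve 5 (λ a c j x z → a :* (c :+ j :* x) :+ j :* z := a :* c :+ j :* (a :* x :+ z)) refl a c j x (L ∸ r) ⟩
    a * c + j * (a * x + (L ∸ r))        ≡⟨ cong (λ z → a * c + j * z) ax+[L∸r]≡[1+q]*L ⟩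
    a * c + j * (suc q * L)              ≡⟨ cong (a * c +_) (sym (*-assoc j (suc q) L)) ⟩
    a * c + j * suc q * L                ∎

i*x+y<[1+i]*x : ∀ {x y} i → y < x → i * x + y < suc i * x
i*x+y<[1+i]*x {x} {y} i y<x = subst (i * x + y <_) (+-comm (i * x) x) (+-monoʳ-< (i * x) y<x)

residue<m : ∀ {x y K m} → y < x → K * x < m → ∀ i → i < K → i * x + y < m
residue<m {x} y<x Kx<m i i<K = <-trans (<-≤-trans (i*x+y<[1+i]*x i y<x) (*-monoˡ-≤ x i<K)) Kx<m

residue-distinct : ∀ {x y K} → y < x → ∀ {i j} → i < j → j < K → i * x + y ≢ j * x + y
residue-distinct {x} {y} y<x {i} {j} i<j _ =
  <⇒≢ (<-≤-trans (i*x+y<[1+i]*x i y<x) (≤-trans (*-monoˡ-≤ x i<j) (m≤m+n (j * x) y)))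

module Cyclic (m : ℕ) .{{_ : NonZero m}} where

  [p+0]%m≡p : ∀ {p} → p < m → (p + 0) % m ≡ p
  [p+0]%m≡p {p} p<m = trans (cong (_% m) (+-identityʳ p)) (m<n⇒m%n≡m p<m)

  [1+p%m+t]%m≡[p+1+t]%m : ∀ p t → (suc p % m + t) % m ≡ (p + suc t) % m
  [1+p%m+t]%m≡[p+1+t]%m p t = trans ([m%n+o]%n≡[m+o]%n (suc p) t m) (cong (_% m) (sym (+-suc p t)))

  offset : ℕ → ℕ → ℕ
  offset A p = (p + (m ∸ A)) % m

  offset-% : ∀ A p → offset A (p % m) ≡ offset A p
  offset-% A p = [m%n+o]%n≡[m+o]%n p (m ∸ A) m

  offset-+≤ : ∀ A p d → offset A ((p + d) % m) ≤ offset A p + d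
  offset-+≤ A p d = begin
    offset A ((p + d) % m)        ≡⟨ offset-% A (p + d) ⟩
    (p + d + (m ∸ A)) % m         ≡⟨ cong (_% m) (xy∙z≈xz∙y p d (m ∸ A)) ⟩
    (p + (m ∸ A) + d) % m         ≡⟨ sym ([m%n+o]%n≡[m+o]%n (p + (m ∸ A)) d m) ⟩
    (offset A p + d) % m          ≤⟨ m%n≤m (offset A p + d) m ⟩
    offset A p + d                ∎
    where open ≤-Reasoning

  offset-∸ : ∀ {A w} → A ≤ m → A ≤ w → offset A (w % m) ≡ (w ∸ A) % m
  offset-∸ {A} {w} A≤m A≤w = begin
    offset A (w % m)                ≡⟨ offset-% A w ⟩
    (w + (m ∸ A)) % m               ≡⟨ cong (λ u → (u + (m ∸ A)) % m) (sym (m∸n+n≡m A≤w)) ⟩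
    (w ∸ A + A + (m ∸ A)) % m       ≡⟨ cong (_% m) (+-assoc (w ∸ A) A (m ∸ A)) ⟩
    (w ∸ A + (A + (m ∸ A))) % m     ≡⟨ cong (λ u → (w ∸ A + u) % m) (m+[n∸m]≡n A≤m) ⟩
    (w ∸ A + m) % m                 ≡⟨ [m+n]%n≡m%n (w ∸ A) m ⟩
    (w ∸ A) % m                     ∎
    where open ≡-Reasoning

  [anchor+offset]%m≡p : ∀ {A p} → A ≤ m → p < m → (A + offset A p) % m ≡ p
  [anchor+offset]%m≡p {A} {p} A≤m p<m = begin
    (A + offset A p) % m          ≡⟨ [m+n%o]%o≡[m+n]%o A (p + (m ∸ A)) m ⟩
    (A + (p + (m ∸ A))) % m       ≡⟨ cong (_% m) (x∙yz≈y∙xz A p (m ∸ A)) ⟩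
    (p + (A + (m ∸ A))) % m       ≡⟨ cong (λ u → (p + u) % m) (m+[n∸m]≡n A≤m) ⟩
    (p + m) % m                   ≡⟨ [m+n]%n≡m%n p m ⟩
    p % m                         ≡⟨ m<n⇒m%n≡m p<m ⟩
    p                             ∎
    where open ≡-Reasoning

  offset-injective : ∀ {A p q} → A ≤ m → p < m → q < m → offset A p ≡ offset A q → p ≡ q
  offset-injective {A} A≤m p<m q<m eq =
    trans (sym ([anchor+offset]%m≡p A≤m p<m)) (trans (cong (λ u → (A + u) % m) eq) ([anchor+offset]%m≡p A≤m q<m))

module LinearProbing (m : ℕ) .{{_ : NonZero m}} (h : ℕ → ℕ) where

  open Cyclic m

  record Placed (occ : List ℕ) (p : ℕ) (result : ℕ × ℕ) : Set where
    field
      displacement : ℕ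
      cost≡        : proj₂ result ≡ suc displacement
      cell≡        : proj₁ result ≡ (p + displacement) % m
      cell-free    : occupied occ (proj₁ result) ≡ false

  probe-spec : ∀ occ f p → p < m →
               Placed occ p (probe m occ f p) ⊎ (∀ t → t < f → occupied occ ((p + t) % m) ≡ true)
  probe-spec occ zero    p p<m = inj₂ λ _ ()
  probe-spec occ (suc f) p p<m with occupied occ p in p-state
  ... | false = inj₁ record { displacement = 0 ; cost≡ = refl ; cell≡ = sym ([p+0]%m≡p p<m) ; cell-free = p-state }
  ... | true with probe-spec occ f (suc p % m) (m%n<n (suc p) m)
  ...   | inj₁ placed = inj₁ record
          { displacement = suc displacement
          ; cost≡        = cong suc cost≡
          ; cell≡        = trans cell≡ ([1+p%m+t]%m≡[p+1+t]%m p displacement)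
          ; cell-free    = cell-free
          }
    where open Placed placed
  ...   | inj₂ occupied-after-p = inj₂ λ where
          zero    _         → subst (λ c → occupied occ c ≡ true) (sym ([p+0]%m≡p p<m)) p-state
          (suc t) (s≤s t<f) → subst (λ c → occupied occ c ≡ true) ([1+p%m+t]%m≡[p+1+t]%m p t) (occupied-after-p t t<f)

  home : ℕ → ℕ
  home k = h k % m

  table : ℕ → List ℕ
  placement : ℕ → ℕ × ℕ

  placement k = probe m (table k) m (home k)

  table zero    = []
  table (suc k) = proj₁ (placement k) ∷ table k

  slot : ℕ → ℕ
  slot k = proj₁ (placement k)

  cost : ℕ → ℕ
  cost k = proj₂ (placement k)

  -- Stated for any f ≗ (k +_), because applyUpTo (k +_) unfolds to applyUpTo (λ i → k + suc i),
  -- not to applyUpTo (suc k +_).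
  insertAll-cost-from : ∀ j k f → (∀ i → f i ≡ k + i) →
                        proj₂ (insertAll m h (table k) (applyUpTo f j)) ≡ ∑[ i < j ] cost (k + i)
  insertAll-cost-from zero    k f f≗k+ = refl
  insertAll-cost-from (suc j) k f f≗k+ rewrite f≗k+ 0 | +-identityʳ k = begin
    cost k + proj₂ (insertAll m h (table (suc k)) (applyUpTo (λ i → f (suc i)) j))
      ≡⟨ cong (cost k +_) (insertAll-cost-from j (suc k) (λ i → f (suc i)) (λ i → trans (f≗k+ (suc i)) (+-suc k i))) ⟩
    cost k + ∑[ i < j ] cost (suc k + i)
      ≡⟨ cong₂ _+_ (cong cost (sym (+-identityʳ k))) (∑-cong j (λ i _ → cong cost (sym (+-suc k i)))) ⟩
    cost (k + 0) + ∑[ i < j ] cost (k + suc i)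
      ≡⟨ sym (∑-unfoldˡ j (λ i → cost (k + i))) ⟩
    ∑[ i < suc j ] cost (k + i) ∎
    where open ≡-Reasoning

  insertAll-cost : ∀ n → proj₂ (insertAll m h [] (upTo n)) ≡ ∑ n cost
  insertAll-cost n = insertAll-cost-from n 0 id (λ _ → refl)

  occupied-table⇒slot : ∀ k v → occupied (table k) v ≡ true → ∃[ j ] j < k × slot j ≡ v
  occupied-table⇒slot (suc k) v v-occupied with slot k ≡ᵇ v | ≡ᵇ⇒≡ (slot k) v
  ... | true  | slot≡v = k , ≤-refl , slot≡v _
  ... | false | _ with j , j<k , slot≡v ← occupied-table⇒slot k v v-occupied = j , m<n⇒m<1+n j<k , slot≡v

  slot-occupied : ∀ {j k} → j < k → occupied (table k) (slot j) ≡ true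
  slot-occupied {j} {suc k} j<1+k with m<1+n⇒m<n∨m≡n j<1+k
  ... | inj₁ j<k  rewrite slot-occupied j<k = ∨-zeroʳ (slot k ≡ᵇ slot j)
  ... | inj₂ refl with slot j ≡ᵇ slot j | ≡⇒≡ᵇ (slot j) (slot j) refl
  ...   | true | _ = refl

  table-not-full : ∀ {k} → k < m → ¬ (∀ v → v < m → occupied (table k) v ≡ true)
  table-not-full {k} k<m full =
    let c , c′ , c<c′ , same = pigeonhole k<m index
    in <-irrefl (trans (sym (slot-index c)) (trans (cong (λ j → slot (toℕ j)) same) (slot-index c′))) c<c′
    where
    earlier : (c : Fin m) → ∃[ j ] j < k × slot j ≡ toℕ c
    earlier c = occupied-table⇒slot k (toℕ c) (full (toℕ c) (toℕ<n c))
    index : Fin m → Fin k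
    index c = fromℕ< (proj₁ (proj₂ (earlier c)))
    slot-index : ∀ c → slot (toℕ (index c)) ≡ toℕ c
    slot-index c = trans (cong slot (toℕ-fromℕ< _)) (proj₂ (proj₂ (earlier c)))

  placed : ∀ {k} → k < m → Placed (table k) (home k) (placement k)
  placed {k} k<m with probe-spec (table k) m (home k) (m%n<n (h k) m)
  ... | inj₁ found           = found
  ... | inj₂ all-scanned-full = ⊥-elim (table-not-full k<m λ v v<m →
          subst (λ c → occupied (table k) c ≡ true) ([anchor+offset]%m≡p (<⇒≤ (m%n<n (h k) m)) v<m)
                (all-scanned-full (offset (home k) v) (m%n<n _ m)))

  slot<m : ∀ {k} → k < m → slot k < m
  slot<m k<m = subst (_< m) (sym (Placed.cell≡ (placed k<m))) (m%n<n _ m)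

  slot-fresh : ∀ {j k} → j < k → k < m → slot j ≢ slot k
  slot-fresh {j} {k} j<k k<m same = case true≡false of λ ()
    where
    true≡false : true ≡ false
    true≡false = trans (sym (slot-occupied j<k)) (trans (cong (occupied (table k)) same) (Placed.cell-free (placed k<m)))

  slot-injective : ∀ {j k} → j < m → k < m → slot j ≡ slot k → j ≡ k
  slot-injective {j} {k} j<m k<m same with <-cmp j k
  ... | tri< j<k _ _ = ⊥-elim (slot-fresh j<k k<m same)
  ... | tri≈ _ j≡k _ = j≡k
  ... | tri> _ _ k<j = ⊥-elim (slot-fresh k<j j<m (sym same))

  offset-slot<offset-home+cost : ∀ A {k} → k < m → suc (offset A (slot k)) ≤ offset A (home k) + cost k
  offset-slot<offset-home+cost A {k} k<m = begin
    suc (offset A (slot k))                           ≡⟨ cong (λ c → suc (offset A c)) cell≡ ⟩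
    suc (offset A ((home k + displacement) % m))      ≤⟨ s≤s (offset-+≤ A (home k) displacement) ⟩
    suc (offset A (home k) + displacement)            ≡⟨ sym (+-suc (offset A (home k)) displacement) ⟩
    offset A (home k) + suc displacement              ≡⟨ cong (offset A (home k) +_) (sym cost≡) ⟩
    offset A (home k) + cost k                        ∎
    where
    open ≤-Reasoning
    open Placed (placed k<m)

  -- The slots of distinct keys are distinct, so their offsets from A sum to at least 0 + 1 + ⋯ + (K−1);
  -- each slot lies cost − 1 cells past its home.
  clustered-cost : ∀ K (key : ℕ → ℕ) {A} → A ≤ m →
                   (∀ i → i < K → key i < m) → (∀ {i j} → i < j → j < K → key i ≢ key j) →
                   2 * ∑[ i < K ] offset A (home (key i)) ≤ ∑[ i < K ] suc i →
                   ∑[ i < K ] suc i ≤ 2 * ∑[ i < K ] cost (key i)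
  clustered-cost K key {A} A≤m key<m key-distinct spread = +-cancelˡ-≤ X X (2 * Cost) (begin
    X + X                     ≡⟨ cong (X +_) (sym (+-identityʳ X)) ⟩
    2 * X                     ≤⟨ *-monoʳ-≤ 2 X≤Home+Cost ⟩
    2 * (Home + Cost)         ≡⟨ *-distribˡ-+ 2 Home Cost ⟩
    2 * Home + 2 * Cost       ≤⟨ +-monoˡ-≤ (2 * Cost) spread ⟩
    X + 2 * Cost              ∎)
    where
    open ≤-Reasoning
    X = ∑[ i < K ] suc i
    Home = ∑[ i < K ] offset A (home (key i))
    Cost = ∑[ i < K ] cost (key i)
    v : ℕ → ℕ
    v i = offset A (slot (key i))
    v-distinct : ∀ {i j} → i < j → j < K → v i ≢ v j
    v-distinct {i} {j} i<j j<K same = key-distinct i<j j<K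
      (slot-injective key-i<m key-j<m (offset-injective A≤m (slot<m key-i<m) (slot<m key-j<m) same))
      where
      key-i<m = key<m i (<-trans i<j j<K)
      key-j<m = key<m j j<K
    X≤Home+Cost : X ≤ Home + Cost
    X≤Home+Cost = begin
      X                                               ≡⟨ ∑-suc K id ⟩
      ∑[ i < K ] i + K                                ≤⟨ +-monoˡ-≤ K (∑-index≤∑-distinct K v v-distinct) ⟩
      ∑ K v + K                                       ≡⟨ sym (∑-suc K v) ⟩
      ∑[ i < K ] suc (v i)                            ≤⟨ ∑-mono-≤ K (λ i i<K → offset-slot<offset-home+cost A (key<m i i<K)) ⟩
      ∑[ i < K ] (offset A (home (key i)) + cost (key i)) ≡⟨ ∑-distrib-+ K _ _ ⟩
      Home + Cost                                     ∎

module MultiplicativeHashing (ℓ ℓout a : ℕ) (ℓout≤ℓ : ℓout ≤ ℓ) where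

  m = 2 ^ ℓout
  s = 2 ^ (ℓ ∸ ℓout)
  L = 2 ^ ℓ

  instance
    m≢0 : NonZero m
    m≢0 = m^n≢0 2 ℓout
    s≢0 : NonZero s
    s≢0 = m^n≢0 2 (ℓ ∸ ℓout)
    L≢0 : NonZero L
    L≢0 = m^n≢0 2 ℓ

  h : ℕ → ℕ
  h = hashA ℓ ℓout a

  open Cyclic m
  open LinearProbing m h

  L≡m*s : L ≡ m * s
  L≡m*s = trans (cong (2 ^_) (sym (m+[n∸m]≡n ℓout≤ℓ))) (^-distribˡ-+-* 2 ℓout (ℓ ∸ ℓout))

  [v%L]/s≡[v/s]%m : ∀ v → v % L / s ≡ v / s % m
  [v%L]/s≡[v/s]%m v = trans (/-congˡ (%-congʳ L≡m*s)) (m%[n*o]/o≡m/o%n v m s)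
    where
    instance
      m*s≢0 : NonZero (m * s)
      m*s≢0 = m*n≢0 m s

  h<m : ∀ k → h k < m
  h<m k = m<n*o⇒m/o<n (subst (a * k % L <_) L≡m*s (m%n<n (a * k) L))

  2*m*δ≤L⇒2*δ≤s : ∀ {δ} → 2 * m * δ ≤ L → 2 * δ ≤ s
  2*m*δ≤L⇒2*δ≤s {δ} 2mδ≤L = *-cancelˡ-≤ m (subst₂ _≤_ (solve 2 (λ m δ → con 2 :* m :* δ := m :* (con 2 :* δ)) refl m δ) L≡m*s 2mδ≤L)

  -- Adding j δ ≤ j 2^(ℓ−ℓout)/2 to the ℓ-bit product moves its top ℓout bits at most (j+1)/2 cells forward.
  home-offset-bound : ∀ {b k j δ} → a * k % L ≡ (a * b % L + j * δ) % L → 2 * m * δ ≤ L →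
                      2 * offset (h b) (home k) ≤ suc j
  home-offset-bound {b} {k} {j} {δ} ak≡ab+jδ 2mδ≤L = begin
    2 * offset (u / s) (h k % m)   ≡⟨ cong (λ c → 2 * offset (u / s) (c % m)) h-k ⟩
    2 * offset (u / s) (w % m % m) ≡⟨ cong (2 *_) (offset-% (u / s) (w % m)) ⟩
    2 * offset (u / s) (w % m)     ≡⟨ cong (2 *_) (offset-∸ (<⇒≤ (h<m b)) (/-monoˡ-≤ s (m≤m+n u (j * δ)))) ⟩
    2 * ((w ∸ u / s) % m)          ≤⟨ *-monoʳ-≤ 2 (m%n≤m (w ∸ u / s) m) ⟩
    2 * (w ∸ u / s)                ≤⟨ 2*[[u+t]/s∸u/s]≤1+j u (j * δ) j s 2jδ≤js ⟩
    suc j                          ∎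
    where
    open ≤-Reasoning
    u = a * b % L
    w = (u + j * δ) / s
    h-k : h k ≡ w % m
    h-k = trans (/-congˡ ak≡ab+jδ) ([v%L]/s≡[v/s]%m (u + j * δ))
    2jδ≤js : 2 * (j * δ) ≤ j * s
    2jδ≤js = subst (_≤ j * s) (solve 2 (λ j δ → j :* (con 2 :* δ) := con 2 :* (j :* δ)) refl j δ) (*-monoʳ-≤ j (2*m*δ≤L⇒2*δ≤s 2mδ≤L))

  residue-class-cost : ∀ {x y K} → NearZero ℓ m a x → y < x → K * x < m →
                       ∑[ i < K ] suc i ≤ 2 * ∑[ i < K ] cost (i * x + y)
  residue-class-cost {x} {y} {K} (low 2mr≤L) y<x Kx<m =
    clustered-cost K key (<⇒≤ (h<m y)) (residue<m y<x Kx<m) (residue-distinct y<x)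
      (*-∑-mono-≤ K 2 home-near-first)
    where
    key : ℕ → ℕ
    key i = i * x + y
    home-near-first : ∀ i → i < K → 2 * offset (h y) (home (key i)) ≤ suc i
    home-near-first i _ = home-offset-bound (a[ix+y]%L a x y i L) 2mr≤L
  residue-class-cost {x} {y} {K} (high 2m[L∸r]≤L) y<x Kx<m =
    clustered-cost K key (<⇒≤ (h<m last)) (residue<m y<x Kx<m) (residue-distinct y<x)
      (subst (2 * ∑[ i < K ] offset (h last) (home (key i)) ≤_) (∑-reverse K suc)
        (*-∑-mono-≤ K 2 home-near-last))
    where
    key : ℕ → ℕ
    key i = i * x + y
    last = key (K ∸ 1)
    key+[K∸1+i]*x≡last : ∀ {i} → i < K → key i + (K ∸ suc i) * x ≡ last
    key+[K∸1+i]*x≡last {i} i<K = begin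
      i * x + y + (K ∸ suc i) * x      ≡⟨ solve 4 (λ i x y j → i :* x :+ y :+ j :* x := (i :+ j) :* x :+ y) refl i x y (K ∸ suc i) ⟩
      (i + (K ∸ suc i)) * x + y        ≡⟨ cong (λ n → n * x + y) (i+[K∸[1+i]]≡K∸1 i<K) ⟩
      (K ∸ 1) * x + y                  ∎
      where
      open ≡-Reasoning
      i+[K∸[1+i]]≡K∸1 : ∀ {i K} → i < K → i + (K ∸ suc i) ≡ K ∸ 1
      i+[K∸[1+i]]≡K∸1 {K = suc K} (s≤s i≤K) = m+[n∸m]≡n i≤K
    home-near-last : ∀ i → i < K → 2 * offset (h last) (home (key i)) ≤ suc (K ∸ suc i)
    home-near-last i i<K = home-offset-bound
      (subst (λ b → a * key i % L ≡ (a * b % L + (K ∸ suc i) * (L ∸ a * x % L)) % L) (key+[K∸1+i]*x≡last i<K)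
             (a[c+jx]%L a x (key i) (K ∸ suc i) L))
      2m[L∸r]≤L

  totalCost-bound : ∀ {n x} → n < m → 1 ≤ x → x < n → NearZero ℓ m a x → n * n ≤ 8 * x * totalCost ℓ ℓout a n
  totalCost-bound {n} {x@(suc _)} n<m _ x<n near = subst (λ c → n * n ≤ 8 * x * c) (sym (insertAll-cost n)) (begin
    n * n                       ≤⟨ *-mono-≤ n≤[1+K]*x n≤[1+K]*x ⟩
    suc K * x * (suc K * x)     ≡⟨ solve 2 (λ k x → k :* x :* (k :* x) := k :* k :* (x :* x)) refl (suc K) x ⟩
    suc K * suc K * (x * x)     ≤⟨ *-monoˡ-≤ (x * x) ([1+n]*[1+n]≤4*∑-suc (m≥n⇒m/n>0 (<⇒≤ x<n))) ⟩
    4 * X * (x * x)             ≡⟨ solve 2 (λ X x → con 4 :* X :* (x :* x) := con 4 :* x :* (x :* X)) refl X x ⟩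
    4 * x * (x * X)             ≤⟨ *-monoʳ-≤ (4 * x) x*X≤2*∑cost ⟩
    4 * x * (2 * ∑ n cost)      ≡⟨ solve 2 (λ x c → con 4 :* x :* (con 2 :* c) := con 8 :* x :* c) refl x (∑ n cost) ⟩
    8 * x * ∑ n cost            ∎)
    where
    open ≤-Reasoning
    K = n / x
    X = ∑[ i < K ] suc i
    n≤[1+K]*x : n ≤ suc K * x
    n≤[1+K]*x = begin
      n                     ≡⟨ m≡m%n+[m/n]*n n x ⟩
      n % x + K * x         ≤⟨ +-monoˡ-≤ (K * x) (m%n≤n n x) ⟩
      x + K * x             ∎
    x*X≤2*∑cost : x * X ≤ 2 * ∑ n cost
    x*X≤2*∑cost = begin
      x * X                                               ≡⟨ sym (∑-const x X) ⟩
      ∑[ y < x ] X                                        ≤⟨ ∑-mono-≤ x (λ y y<x → residue-class-cost {K = K} near y<x (≤-<-trans (m/n*n≤m n x) n<m)) ⟩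
      ∑[ y < x ] (2 * ∑[ i < K ] cost (i * x + y))        ≡⟨ ∑-distribˡ-* x 2 _ ⟩
      2 * ∑[ y < x ] ∑[ i < K ] cost (i * x + y)          ≡⟨ cong (2 *_) (sym (∑-blocks K x cost)) ⟩
      2 * ∑ (K * x) cost                                  ≤⟨ *-monoʳ-≤ 2 (∑-monoˡ-≤ cost (m/n*n≤m n x)) ⟩
      2 * ∑ n cost                                        ∎

lemma6 : Σ ℕ (λ c → 1 ≤ c × ((ℓ ℓout a n x : ℕ) → 1 ≤ ℓout → ℓout ≤ ℓ → a < 2 ^ ℓ → n < 2 ^ ℓout → 1 ≤ x → x < n → NearZero ℓ (2 ^ ℓout) a x → n * n ≤ c * x * totalCost ℓ ℓout a n))
lemma6 = 8 , s≤s z≤n , λ ℓ ℓout a n x _ ℓout≤ℓ _ n<m 1≤x x<n near →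
  MultiplicativeHashing.totalCost-bound ℓ ℓout a ℓout≤ℓ n<m 1≤x x<n near
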